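{- Let $\mathbf L=(L,\lor,\land,*,1)$ be a lattice skew Hilbert algebra and $F\subseteq L$. Let $t(x,y,z,u):=(x\lor y)\land(z*y)\land u$ and $t_2(x_1,x_2,x_3,x_4,y_1,y_2,y_3,y_4):=(t(x_1,x_2,y_1,y_2)\lor t(x_3,x_4,y_3,y_4))*(x_2\lor x_4)$, $t_3(x_1,x_2,x_3,x_4,y_1,y_2,y_3,y_4):=(t(x_1,x_2,y_1,y_2)\land t(x_3,x_4,y_3,y_4))*(x_2\land x_4)$, $t_4(x_1,x_2,x_3,x_4,y_1,y_2,y_3,y_4):=(t(x_1,x_2,y_1,y_2)*t(x_3,x_4,y_3,y_4))*(x_2*x_4)$. Then $F$ is a filter of $\mathbf L$ if and only if $1\in F$ and $t_i(a_1,a_2,a_3,a_4,b_1,b_2,b_3,b_4)\in F$ for all $i\in\{2,3,4\}$, all $a_1,\dots,a_4\in L$ and all $b_1,\dots,b_4\in F$.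
   Context: A lattice skew Hilbert algebra is an algebra $(L,\lor,\land,*,1)$ where $(L,\lor,\land)$ is a lattice and the identities $x*(x\lor y)\approx1$, $x*((x*y)*y)\approx1$, $((x\lor y)*z)*(x*z)\approx1$, $(x\lor y)\land(x*y)\approx y$ hold. A filter of $\mathbf L$ is a subset $F\subseteq L$ containing $1$ such that for all $x,y,z,v\in L$, if $x*y,y*x,z*v,v*z\in F$ then $(x\lor z)*(y\lor v)$, $(x\land z)*(y\land v)$, $(x*z)*(y*v)\in F$. -}

module Defs where

open import Level using (Level; suc; _⊔_)
open import Relation.Binary.PropositionalEquality using (_≡_)
open import Algebra.Lattice.Structures using (IsLattice)
open import Data.Product using (_×_)

record LatticeSkewHilbertAlgebra (a : Level) : Set (suc a) where
  infixr 6 _∨_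
  infixr 7 _∧_
  infixr 5 _*_
  field
    Carrier   : Set a
    _∨_       : Carrier → Carrier → Carrier
    _∧_       : Carrier → Carrier → Carrier
    _*_       : Carrier → Carrier → Carrier
    𝟏         : Carrier
    isLattice : IsLattice _≡_ _∨_ _∧_
    ax₁ : ∀ x y → x * (x ∨ y) ≡ 𝟏
    ax₂ : ∀ x y → x * ((x * y) * y) ≡ 𝟏
    ax₃ : ∀ x y z → ((x ∨ y) * z) * (x * z) ≡ 𝟏
    ax₄ : ∀ x y → (x ∨ y) ∧ (x * y) ≡ y

module _ {a : Level} (𝐋 : LatticeSkewHilbertAlgebra a) where
  open LatticeSkewHilbertAlgebra 𝐋

  IsFilter : {ℓ : Level} → (Carrier → Set ℓ) → Set (a ⊔ ℓ)
  IsFilter F =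
    F 𝟏 ×
    (∀ x y z v → F (x * y) → F (y * x) → F (z * v) → F (v * z) →
       F ((x ∨ z) * (y ∨ v)) × F ((x ∧ z) * (y ∧ v)) × F ((x * z) * (y * v)))

  t : Carrier → Carrier → Carrier → Carrier → Carrier
  t x y z u = ((x ∨ y) ∧ (z * y)) ∧ u

  t₂ t₃ t₄ : Carrier → Carrier → Carrier → Carrier →
             Carrier → Carrier → Carrier → Carrier → Carrier
  t₂ x₁ x₂ x₃ x₄ y₁ y₂ y₃ y₄ = (t x₁ x₂ y₁ y₂ ∨ t x₃ x₄ y₃ y₄) * (x₂ ∨ x₄)
  t₃ x₁ x₂ x₃ x₄ y₁ y₂ y₃ y₄ = (t x₁ x₂ y₁ y₂ ∧ t x₃ x₄ y₃ y₄) * (x₂ ∧ x₄)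
  t₄ x₁ x₂ x₃ x₄ y₁ y₂ y₃ y₄ = (t x₁ x₂ y₁ y₂ * t x₃ x₄ y₃ y₄) * (x₂ * x₄)

-- A filter F induces the relation x ∼ y :⇔ x * y ∈ F and y * x ∈ F, and the
-- filter condition says precisely that ∼ is compatible with ∨, ∧ and *.
-- Every b ∈ F satisfies b ∼ 𝟏 and t(x,y,𝟏,𝟏) = y, so t(a₁,a₂,b₁,b₂) ∼ a₂ and
-- hence tᵢ ∈ F.  Conversely t(x,y,x * y,y * x) = x, so choosing the bᵢ to be
-- the residuals x * y, y * x, z * v, v * z turns t₂, t₃, t₄ into the three
-- terms of the filter condition.
module Submission where

open import Defs
open import Level using (Level; _⊔_)
open import Data.Product using (_×_; _,_; proj₁; proj₂)
open import Function.Bundles using (_⇔_; mk⇔)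
open import Relation.Binary.PropositionalEquality
open import Algebra.Lattice.Bundles using (Lattice)
import Algebra.Lattice.Properties.Lattice as LatticeProperties

module Properties {a : Level} (𝐋 : LatticeSkewHilbertAlgebra a) where
  open LatticeSkewHilbertAlgebra 𝐋
  open ≡-Reasoning

  lattice : Lattice a a
  lattice = record { isLattice = isLattice }

  open Lattice lattice using (∨-comm; ∨-assoc; ∧-comm; ∨-absorbs-∧; ∧-absorbs-∨)
  open LatticeProperties lattice using (∨-idem)

  *-self≡𝟏 : ∀ x → x * x ≡ 𝟏
  *-self≡𝟏 x = trans (cong (x *_) (sym (∨-idem x))) (ax₁ x x)

  ∧-identityʳ : ∀ x → x ∧ 𝟏 ≡ x
  ∧-identityʳ x = begin
    x ∧ 𝟏              ≡⟨ cong₂ _∧_ (sym (∨-idem x)) (sym (*-self≡𝟏 x)) ⟩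
    (x ∨ x) ∧ (x * x)  ≡⟨ ax₄ x x ⟩
    x                  ∎

  ∨-zeroˡ : ∀ x → 𝟏 ∨ x ≡ 𝟏
  ∨-zeroˡ x = begin
    𝟏 ∨ x        ≡⟨ cong (𝟏 ∨_) (sym (∧-identityʳ x)) ⟩
    𝟏 ∨ (x ∧ 𝟏)  ≡⟨ cong (𝟏 ∨_) (∧-comm x 𝟏) ⟩
    𝟏 ∨ (𝟏 ∧ x)  ≡⟨ ∨-absorbs-∧ 𝟏 x ⟩
    𝟏            ∎

  ∨-zeroʳ : ∀ x → x ∨ 𝟏 ≡ 𝟏
  ∨-zeroʳ x = trans (∨-comm x 𝟏) (∨-zeroˡ x)

  *-identityˡ : ∀ x → 𝟏 * x ≡ x
  *-identityˡ x = begin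
    𝟏 * x              ≡⟨ sym (∧-identityʳ (𝟏 * x)) ⟩
    (𝟏 * x) ∧ 𝟏        ≡⟨ ∧-comm (𝟏 * x) 𝟏 ⟩
    𝟏 ∧ (𝟏 * x)        ≡⟨ cong (_∧ (𝟏 * x)) (sym (∨-zeroˡ x)) ⟩
    (𝟏 ∨ x) ∧ (𝟏 * x)  ≡⟨ ax₄ 𝟏 x ⟩
    x                  ∎

  *-zeroʳ : ∀ x → x * 𝟏 ≡ 𝟏
  *-zeroʳ x = trans (cong (x *_) (sym (∨-zeroʳ x))) (ax₁ x 𝟏)

  *≡𝟏⇒∨≡ : ∀ x y → x * y ≡ 𝟏 → x ∨ y ≡ y
  *≡𝟏⇒∨≡ x y x*y≡𝟏 = begin
    x ∨ y              ≡⟨ sym (∧-identityʳ (x ∨ y)) ⟩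
    (x ∨ y) ∧ 𝟏        ≡⟨ cong ((x ∨ y) ∧_) (sym x*y≡𝟏) ⟩
    (x ∨ y) ∧ (x * y)  ≡⟨ ax₄ x y ⟩
    y                  ∎

  ∨-absorbs-* : ∀ x y → y ∨ (x * y) ≡ x * y
  ∨-absorbs-* x y = begin
    y ∨ (x * y)                    ≡⟨ cong (_∨ (x * y)) (sym (ax₄ x y)) ⟩
    ((x ∨ y) ∧ (x * y)) ∨ (x * y)  ≡⟨ ∨-comm _ (x * y) ⟩
    (x * y) ∨ ((x ∨ y) ∧ (x * y))  ≡⟨ cong ((x * y) ∨_) (∧-comm (x ∨ y) (x * y)) ⟩
    (x * y) ∨ ((x * y) ∧ (x ∨ y))  ≡⟨ ∨-absorbs-∧ (x * y) (x ∨ y) ⟩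
    x * y                          ∎

  t[x,y,𝟏,𝟏]≡y : ∀ x y → t 𝐋 x y 𝟏 𝟏 ≡ y
  t[x,y,𝟏,𝟏]≡y x y = begin
    ((x ∨ y) ∧ (𝟏 * y)) ∧ 𝟏  ≡⟨ ∧-identityʳ _ ⟩
    (x ∨ y) ∧ (𝟏 * y)        ≡⟨ cong ((x ∨ y) ∧_) (*-identityˡ y) ⟩
    (x ∨ y) ∧ y              ≡⟨ ∧-comm (x ∨ y) y ⟩
    y ∧ (x ∨ y)              ≡⟨ cong (y ∧_) (∨-comm x y) ⟩
    y ∧ (y ∨ x)              ≡⟨ ∧-absorbs-∨ y x ⟩
    y                        ∎

  t[x,y,x*y,y*x]≡x : ∀ x y → t 𝐋 x y (x * y) (y * x) ≡ x
  t[x,y,x*y,y*x]≡x x y = begin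
    ((x ∨ y) ∧ w) ∧ (y * x)              ≡⟨ cong (λ q → ((x ∨ y) ∧ q) ∧ (y * x)) (sym x∨y∨w≡w) ⟩
    ((x ∨ y) ∧ ((x ∨ y) ∨ w)) ∧ (y * x)  ≡⟨ cong (_∧ (y * x)) (∧-absorbs-∨ (x ∨ y) w) ⟩
    (x ∨ y) ∧ (y * x)                    ≡⟨ cong (_∧ (y * x)) (∨-comm x y) ⟩
    (y ∨ x) ∧ (y * x)                    ≡⟨ ax₄ y x ⟩
    x                                    ∎
    where
    w = (x * y) * y

    x∨y∨w≡w : (x ∨ y) ∨ w ≡ w
    x∨y∨w≡w = begin
      (x ∨ y) ∨ w  ≡⟨ ∨-assoc x y w ⟩
      x ∨ (y ∨ w)  ≡⟨ cong (x ∨_) (∨-absorbs-* (x * y) y) ⟩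
      x ∨ w        ≡⟨ *≡𝟏⇒∨≡ x w (ax₂ x y) ⟩
      w            ∎

module FilterCongruence {a ℓ : Level} (𝐋 : LatticeSkewHilbertAlgebra a)
                        (F : LatticeSkewHilbertAlgebra.Carrier 𝐋 → Set ℓ)
                        (isFilter : IsFilter 𝐋 F) where
  open LatticeSkewHilbertAlgebra 𝐋
  open Properties 𝐋

  F𝟏 : F 𝟏
  F𝟏 = proj₁ isFilter

  compatible : ∀ x y z v → F (x * y) → F (y * x) → F (z * v) → F (v * z) →
    F ((x ∨ z) * (y ∨ v)) × F ((x ∧ z) * (y ∧ v)) × F ((x * z) * (y * v))
  compatible = proj₂ isFilter

  infix 4 _∼_
  _∼_ : Carrier → Carrier → Set ℓ
  x ∼ y = F (x * y) × F (y * x)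

  ∼-refl : ∀ x → x ∼ x
  ∼-refl x = F[x*x] , F[x*x]
    where F[x*x] = subst F (sym (*-self≡𝟏 x)) F𝟏

  ∈F⇒∼𝟏 : ∀ {b} → F b → b ∼ 𝟏
  ∈F⇒∼𝟏 {b} Fb = subst F (sym (*-zeroʳ b)) F𝟏 , subst F (sym (*-identityˡ b)) Fb

  ∨-cong : ∀ {x y z v} → x ∼ y → z ∼ v → x ∨ z ∼ y ∨ v
  ∨-cong {x} {y} {z} {v} (p , q) (r , s) =
    proj₁ (compatible x y z v p q r s) , proj₁ (compatible y x v z q p s r)

  ∧-cong : ∀ {x y z v} → x ∼ y → z ∼ v → x ∧ z ∼ y ∧ v
  ∧-cong {x} {y} {z} {v} (p , q) (r , s) =
    proj₁ (proj₂ (compatible x y z v p q r s)) , proj₁ (proj₂ (compatible y x v z q p s r))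

  *-cong : ∀ {x y z v} → x ∼ y → z ∼ v → x * z ∼ y * v
  *-cong {x} {y} {z} {v} (p , q) (r , s) =
    proj₂ (proj₂ (compatible x y z v p q r s)) , proj₂ (proj₂ (compatible y x v z q p s r))

  t∼ : ∀ a₁ a₂ {b₁ b₂} → F b₁ → F b₂ → t 𝐋 a₁ a₂ b₁ b₂ ∼ a₂
  t∼ a₁ a₂ Fb₁ Fb₂ = subst (t 𝐋 a₁ a₂ _ _ ∼_) (t[x,y,𝟏,𝟏]≡y a₁ a₂)
    (∧-cong (∧-cong (∼-refl (a₁ ∨ a₂)) (*-cong (∈F⇒∼𝟏 Fb₁) (∼-refl a₂))) (∈F⇒∼𝟏 Fb₂))

module _ {a ℓ : Level} (𝐋 : LatticeSkewHilbertAlgebra a)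
         (F : LatticeSkewHilbertAlgebra.Carrier 𝐋 → Set ℓ) where
  open LatticeSkewHilbertAlgebra 𝐋
  open Properties 𝐋

  TTermsClosed : Set (a ⊔ ℓ)
  TTermsClosed = ∀ a₁ a₂ a₃ a₄ b₁ b₂ b₃ b₄ → F b₁ → F b₂ → F b₃ → F b₄
    → F (t₂ 𝐋 a₁ a₂ a₃ a₄ b₁ b₂ b₃ b₄)
      × F (t₃ 𝐋 a₁ a₂ a₃ a₄ b₁ b₂ b₃ b₄)
      × F (t₄ 𝐋 a₁ a₂ a₃ a₄ b₁ b₂ b₃ b₄)

  filter⇒tTermsClosed : IsFilter 𝐋 F → TTermsClosed
  filter⇒tTermsClosed isFilter a₁ a₂ a₃ a₄ _ _ _ _ Fb₁ Fb₂ Fb₃ Fb₄ =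
    proj₁ (∨-cong t₁₂∼a₂ t₃₄∼a₄) , proj₁ (∧-cong t₁₂∼a₂ t₃₄∼a₄) , proj₁ (*-cong t₁₂∼a₂ t₃₄∼a₄)
    where
    open FilterCongruence 𝐋 F isFilter
    t₁₂∼a₂ : t 𝐋 a₁ a₂ _ _ ∼ a₂
    t₁₂∼a₂ = t∼ a₁ a₂ Fb₁ Fb₂
    t₃₄∼a₄ : t 𝐋 a₃ a₄ _ _ ∼ a₄
    t₃₄∼a₄ = t∼ a₃ a₄ Fb₃ Fb₄

  tTermsClosed⇒filter : F 𝟏 → TTermsClosed → IsFilter 𝐋 F
  tTermsClosed⇒filter F𝟏 closed = F𝟏 , λ x y z v p q r s →
    let F[t₂] , F[t₃] , F[t₄] = closed x y z v (x * y) (y * x) (z * v) (v * z) p q r s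
        substₜ : (f : Carrier → Carrier → Carrier) → F (f (t 𝐋 x y (x * y) (y * x)) (t 𝐋 z v (z * v) (v * z))) → F (f x z)
        substₜ f = subst F (cong₂ f (t[x,y,x*y,y*x]≡x x y) (t[x,y,x*y,y*x]≡x z v))
    in substₜ (λ p q → (p ∨ q) * (y ∨ v)) F[t₂]
     , substₜ (λ p q → (p ∧ q) * (y ∧ v)) F[t₃]
     , substₜ (λ p q → (p * q) * (y * v)) F[t₄]

mainTheorem17 : {a ℓ : Level} (𝐋 : LatticeSkewHilbertAlgebra a)
    → (F : LatticeSkewHilbertAlgebra.Carrier 𝐋 → Set ℓ)
    → IsFilter 𝐋 F
      ⇔ (F (LatticeSkewHilbertAlgebra.𝟏 𝐋)
         × (∀ a₁ a₂ a₃ a₄ b₁ b₂ b₃ b₄ → F b₁ → F b₂ → F b₃ → F b₄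
            → F (t₂ 𝐋 a₁ a₂ a₃ a₄ b₁ b₂ b₃ b₄)
              × F (t₃ 𝐋 a₁ a₂ a₃ a₄ b₁ b₂ b₃ b₄)
              × F (t₄ 𝐋 a₁ a₂ a₃ a₄ b₁ b₂ b₃ b₄)))
mainTheorem17 𝐋 F = mk⇔
  (λ isFilter → proj₁ isFilter , filter⇒tTermsClosed 𝐋 F isFilter)
  (λ (F𝟏 , closed) → tTermsClosed⇒filter 𝐋 F F𝟏 closed)
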